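{- Let $\mathcal{F}$ be a finite signature, $\mathcal{A}$ a weakly monotone well-founded ordered $\mathcal{F}$-algebra, and $\succsim$ a precedence on $\mathcal{F}$. Define relations on $\mathcal{T}(\mathcal{F},\mathcal{V})\setminus\mathcal{V}$ as follows: for $s = f(s_1,\dots,s_m)$ and $t = g(t_1,\dots,t_n)$, $s \mathrel{\sqsupset\!\!\!\sim} t$ iff $s >_\mathcal{A} t$, or both $s \geqslant_\mathcal{A} t$ and $f \succsim g$; and $s \sqsupset t$ iff $s >_\mathcal{A} t$, or both $s \geqslant_\mathcal{A} t$ and $f \succ g$. Then $(\mathrel{\sqsupset\!\!\!\sim},\sqsupset)$ is a stable order pair on $\mathcal{T}(\mathcal{F},\mathcal{V})\setminus\mathcal{V}$ and $\sqsupset$ is well-founded.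
   Context: A precedence is a quasi-order $\succsim$ on $\mathcal{F}$, with strict part $\succ$. An ordered $\mathcal{F}$-algebra $\mathcal{A} = (A, \{f_\mathcal{A}\}_{f\in\mathcal{F}}, >)$ consists of a set $A$, a strict order $>$ on $A$, and an $n$-ary function $f_\mathcal{A}$ on $A$ for each $n$-ary $f\in\mathcal{F}$; $\geqslant$ is the reflexive closure of $>$. For an assignment $\alpha:\mathcal{V}\to A$, $[\alpha]_\mathcal{A}(t)$ is the usual evaluation of a term. $s >_\mathcal{A} t$ means $[\alpha]_\mathcal{A}(s) > [\alpha]_\mathcal{A}(t)$ for all assignments $\alpha$; $s \geqslant_\mathcal{A} t$ means $[\alpha]_\mathcal{A}(s) \geqslant [\alpha]_\mathcal{A}(t)$ for all $\alpha$. $\mathcal{A}$ is weakly monotone if $f_\mathcal{A}(a_1,\dots,a_i,\dots,a_n) \geqslant f_\mathcal{A}(a_1,\dots,b,\dots,a_n)$ for all $f$, positions $i$, and $a_1,\dots,a_n,b\in A$ with $a_i > b$; it is well-founded if $>$ is well-founded. A pair $(\gtrsim,>)$ of a quasi-order and a strict order is an order pair if ${\gtrsim}\cdot{>}\cdot{\gtrsim}\subseteq{>}$; it is stable if both relations are closed under substitutions. -}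

module Defs where

open import Data.Nat using (ℕ)
open import Data.Fin using (Fin)
open import Data.Vec using (Vec; []; _∷_; lookup; _[_]≔_)
open import Data.List using (List)
open import Data.List.Membership.Propositional using (_∈_)
open import Data.Product using (Σ; ∃; _×_; _,_; proj₁)
open import Data.Sum using (_⊎_)
open import Data.Unit using (⊤)
open import Data.Empty using (⊥)
open import Relation.Nullary using (¬_)
open import Relation.Binary.Core using (Rel)
open import Level using (0ℓ)
open import Relation.Binary.Structures using (IsPreorder; IsStrictPartialOrder)
open import Relation.Binary.PropositionalEquality using (_≡_)
open import Induction.WellFounded using (WellFounded)
open import Function using (flip)

record Signature : Set₁ where
  field
    Sym   : Set
    arity : Sym → ℕ
open Signature public

FiniteSignature : Signature → Set
FiniteSignature F = ∃ λ (l : List (Sym F)) → ∀ f → f ∈ l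

data Term (F : Signature) (V : Set) : Set where
  var : V → Term F V
  fun : (f : Sym F) → Vec (Term F V) (arity F f) → Term F V

module _ {F : Signature} {V : Set} (σ : V → Term F V) where
  mutual
    _·σ : Term F V → Term F V
    var x ·σ    = σ x
    fun f ts ·σ = fun f (substs ts)

    substs : ∀ {n} → Vec (Term F V) n → Vec (Term F V) n
    substs []       = []
    substs (t ∷ ts) = (t ·σ) ∷ substs ts

_⟨_⟩ : {F : Signature} {V : Set} → Term F V → (V → Term F V) → Term F V
t ⟨ σ ⟩ = _·σ σ t

NonVar : {F : Signature} {V : Set} → Term F V → Set
NonVar (var _)   = ⊥
NonVar (fun _ _) = ⊤

NTerm : Signature → Set → Set
NTerm F V = Σ (Term F V) NonVar

root : {F : Signature} {V : Set} → NTerm F V → Sym F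
root (var _ , ())
root (fun f _ , _) = f

substNV : {F : Signature} {V : Set} → (V → Term F V) → NTerm F V → NTerm F V
substNV σ (var _ , ())
substNV σ (fun f ts , _) = (fun f ts ⟨ σ ⟩ , Data.Unit.tt)

record OrderedAlgebra (F : Signature) : Set₁ where
  field
    Carrier : Set
    _>_     : Rel Carrier 0ℓ
    isStrictOrder : IsStrictPartialOrder _≡_ _>_
    interp  : (f : Sym F) → Vec Carrier (arity F f) → Carrier
    -- carriers of algebras are nonempty (standard convention)
    inhabitant : Carrier

  _⩾_ : Rel Carrier 0ℓ
  a ⩾ b = a > b ⊎ a ≡ b

module _ {F : Signature} (𝒜 : OrderedAlgebra F) where
  open OrderedAlgebra 𝒜

  WeaklyMonotone : Set
  WeaklyMonotone = ∀ (f : Sym F) (i : Fin (arity F f))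
    (as : Vec Carrier (arity F f)) (b : Carrier) →
    lookup as i > b → interp f as ⩾ interp f (as [ i ]≔ b)

  WellFoundedAlg : Set
  WellFoundedAlg = WellFounded (flip _>_)

  module _ {V : Set} where
    mutual
      eval : (V → Carrier) → Term F V → Carrier
      eval α (var x)    = α x
      eval α (fun f ts) = interp f (evals α ts)

      evals : ∀ {n} → (V → Carrier) → Vec (Term F V) n → Vec Carrier n
      evals α []       = []
      evals α (t ∷ ts) = eval α t ∷ evals α ts

    _>𝒜_ : Rel (Term F V) 0ℓ
    s >𝒜 t = ∀ (α : V → Carrier) → eval α s > eval α t

    _⩾𝒜_ : Rel (Term F V) 0ℓ
    s ⩾𝒜 t = ∀ (α : V → Carrier) → eval α s ⩾ eval α t

IsPrecedence : (F : Signature) → Rel (Sym F) 0ℓ → Set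
IsPrecedence F _≿_ = IsPreorder _≡_ _≿_

StrictPart : {S : Set} → Rel S 0ℓ → Rel S 0ℓ
StrictPart _≿_ f g = f ≿ g × ¬ (g ≿ f)

module _ {F : Signature} (𝒜 : OrderedAlgebra F) (_≿_ : Rel (Sym F) 0ℓ) {V : Set} where
  ⊐∼ : Rel (NTerm F V) 0ℓ
  ⊐∼ s t = (_>𝒜_ 𝒜 (proj₁ s) (proj₁ t))
         ⊎ (_⩾𝒜_ 𝒜 (proj₁ s) (proj₁ t) × root s ≿ root t)

  ⊐ : Rel (NTerm F V) 0ℓ
  ⊐ s t = (_>𝒜_ 𝒜 (proj₁ s) (proj₁ t))
        ⊎ (_⩾𝒜_ 𝒜 (proj₁ s) (proj₁ t) × StrictPart _≿_ (root s) (root t))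

record IsOrderPair {T : Set} (_≳_ _≻_ : Rel T 0ℓ) : Set where
  field
    quasi  : IsPreorder _≡_ _≳_
    strict : IsStrictPartialOrder _≡_ _≻_
    compat : ∀ {a b c d} → a ≳ b → b ≻ c → c ≳ d → a ≻ d

IsStableOrderPair : (F : Signature) (V : Set) → Rel (NTerm F V) 0ℓ → Rel (NTerm F V) 0ℓ → Set
IsStableOrderPair F V _≳_ _≻_ =
  IsOrderPair _≳_ _≻_
  × (∀ (σ : V → Term F V) {s t} → s ≳ t → substNV σ s ≳ substNV σ t)
  × (∀ (σ : V → Term F V) {s t} → s ≻ t → substNV σ s ≻ substNV σ t)

{-# OPTIONS --safe #-}
module Submission where

-- Both relations refine the pointwise order pair (≥𝒜, >𝒜) by the precedence on root
-- symbols, and refining an order pair on T by a quasi-order on an attribute T → S gives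
-- again an order pair. Stability holds because substitution keeps the root and
-- evaluating t⟨σ⟩ under α is evaluating t under eval α ∘ σ. For well-foundedness fix one
-- assignment α₀: s ⊐ t makes (⟦s⟧α₀, root s) decrease lexicographically, and the strict
-- part of a quasi-order on a finite set is well-founded.

open import Defs
open import Relation.Binary.Core using (Rel)
open import Relation.Binary.Definitions using (Trans)
open import Relation.Binary.Structures using (IsPreorder; IsStrictPartialOrder)
open import Relation.Binary.PropositionalEquality
  using (_≡_; refl; sym; cong; cong₂; subst₂; resp₂; isEquivalence)
import Relation.Binary.Construct.StrictToNonStrict as StrictToNonStrict
import Relation.Binary.Construct.On as On
open import Level using (0ℓ)
open import Data.Product using (_×_; _,_; proj₁; proj₂)
open import Data.Product.Relation.Binary.Lex.Strict using (×-Lex; ×-wellFounded)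
open import Data.Sum using (_⊎_; inj₁; inj₂)
open import Data.Unit using (tt)
open import Data.List using (List; lookup; length)
open import Data.List.Membership.Propositional using (_∈_)
open import Data.List.Relation.Unary.Any using (index)
open import Data.List.Relation.Unary.Any.Properties using (lookup-index)
open import Data.Fin using (Fin)
open import Data.Fin.Induction using (spo-noetherian)
open import Data.Vec using (Vec; []; _∷_)
open import Induction.WellFounded using (WellFounded; module Subrelation)
open import Function using (flip; _∘_; _on_)

module StrictPartProperties {S : Set} {_≿_ : Rel S 0ℓ} (≿-isPreorder : IsPreorder _≡_ _≿_) where
  open IsPreorder ≿-isPreorder using () renaming (trans to ≿-trans)

  _≻_ : Rel S 0ℓ
  _≻_ = StrictPart _≿_

  ≿-≻-trans : Trans _≿_ _≻_ _≻_
  ≿-≻-trans f≿g (g≿h , h≵g) = ≿-trans f≿g g≿h , λ h≿f → h≵g (≿-trans h≿f f≿g)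

  ≻-≿-trans : Trans _≻_ _≿_ _≻_
  ≻-≿-trans (f≿g , g≵f) g≿h = ≿-trans f≿g g≿h , λ h≿f → g≵f (≿-trans g≿h h≿f)

  ≻-isStrictPartialOrder : IsStrictPartialOrder _≡_ _≻_
  ≻-isStrictPartialOrder = record
    { isEquivalence = isEquivalence
    ; irrefl        = λ { refl (f≿f , f≵f) → f≵f f≿f }
    ; trans         = λ f≻g → ≿-≻-trans (proj₁ f≻g)
    ; <-resp-≈      = resp₂ _≻_
    }

  ≻-noetherian : (l : List S) → (∀ f → f ∈ l) → WellFounded (flip _≻_)
  -- Positions in the enumeration carry ≻ to a strict order on Fin (length l).
  ≻-noetherian l enum =
    Subrelation.wellFounded toIndices (On.wellFounded position lookupOrder-noetherian)
    where
      position : S → Fin (length l)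
      position f = index (enum f)

      lookupOrder-noetherian : WellFounded (flip (_≻_ on lookup l))
      lookupOrder-noetherian =
        spo-noetherian (On.isStrictPartialOrder (lookup l) ≻-isStrictPartialOrder)

      toIndices : ∀ {f g} → g ≻ f → lookup l (position g) ≻ lookup l (position f)
      toIndices {f} {g} = subst₂ _≻_ (lookup-index (enum g)) (lookup-index (enum f))

module Pointwise {I T C : Set} {_>_ : Rel C 0ℓ} (>-isStrictPartialOrder : IsStrictPartialOrder _≡_ _>_)
  (⟦_⟧ : I → T → C) where
  open IsStrictPartialOrder >-isStrictPartialOrder using (irrefl) renaming (trans to >-trans)
  open StrictToNonStrict _≡_ _>_ using (<-≤-trans; ≤-<-trans; isPreorder₂) renaming (_≤_ to _≥_)
  open IsPreorder (isPreorder₂ >-isStrictPartialOrder) using () renaming (refl to ≥-refl; trans to ≥-trans)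

  _>ᵖ_ : Rel T 0ℓ
  s >ᵖ t = ∀ i → ⟦ i ⟧ s > ⟦ i ⟧ t

  _≥ᵖ_ : Rel T 0ℓ
  s ≥ᵖ t = ∀ i → ⟦ i ⟧ s ≥ ⟦ i ⟧ t

  pointwise-isOrderPair : I → IsOrderPair _≥ᵖ_ _>ᵖ_
  pointwise-isOrderPair i₀ = record
    { quasi  = record
      { isEquivalence = isEquivalence
      ; reflexive     = λ { refl i → ≥-refl }
      ; trans         = λ s≥t t≥u i → ≥-trans (s≥t i) (t≥u i)
      }
    ; strict = record
      { isEquivalence = isEquivalence
      ; irrefl        = λ s≡t s>t → irrefl (cong ⟦ i₀ ⟧ s≡t) (s>t i₀)
      ; trans         = λ s>t t>u i → >-trans (s>t i) (t>u i)
      ; <-resp-≈      = resp₂ _>ᵖ_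
      }
    ; compat = λ a≥b b>c c≥d i →
        ≤-<-trans sym >-trans (resp₂ _>_ .proj₂) (a≥b i)
          (<-≤-trans >-trans (resp₂ _>_ .proj₁) (b>c i) (c≥d i))
    }

  module _ (h : T → T) (reindex : I → I) (⟦h⟧ : ∀ i t → ⟦ i ⟧ (h t) ≡ ⟦ reindex i ⟧ t) where
    >ᵖ-reindex : ∀ s t → s >ᵖ t → h s >ᵖ h t
    >ᵖ-reindex s t s>t i = subst₂ _>_ (sym (⟦h⟧ i s)) (sym (⟦h⟧ i t)) (s>t (reindex i))

    ≥ᵖ-reindex : ∀ s t → s ≥ᵖ t → h s ≥ᵖ h t
    ≥ᵖ-reindex s t s≥t i = subst₂ _≥_ (sym (⟦h⟧ i s)) (sym (⟦h⟧ i t)) (s≥t (reindex i))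

module RootRefinement {T S : Set} {_≳_ _>_ : Rel T 0ℓ} (pair : IsOrderPair _≳_ _>_)
  (root : T → S) {_≿_ : Rel S 0ℓ} (≿-isPreorder : IsPreorder _≡_ _≿_) where
  open IsOrderPair pair
  open IsPreorder quasi using () renaming (refl to ≳-refl; trans to ≳-trans)
  open IsStrictPartialOrder strict using () renaming (irrefl to >-irrefl; trans to >-trans)
  open IsPreorder ≿-isPreorder using () renaming (refl to ≿-refl; trans to ≿-trans)
  open StrictPartProperties ≿-isPreorder

  Refine : Rel S 0ℓ → Rel T 0ℓ
  Refine R s t = s > t ⊎ (s ≳ t × R (root s) (root t))

  refine-trans : ∀ {R₁ R₂ R₃} → Trans R₁ R₂ R₃ → Trans (Refine R₁) (Refine R₂) (Refine R₃)
  refine-trans _ (inj₁ s>t)       (inj₁ t>u)       = inj₁ (>-trans s>t t>u)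
  refine-trans _ (inj₁ s>t)       (inj₂ (t≳u , _)) = inj₁ (compat ≳-refl s>t t≳u)
  refine-trans _ (inj₂ (s≳t , _)) (inj₁ t>u)       = inj₁ (compat s≳t t>u ≳-refl)
  refine-trans trans (inj₂ (s≳t , r₁)) (inj₂ (t≳u , r₂)) = inj₂ (≳-trans s≳t t≳u , trans r₁ r₂)

  refine-isOrderPair : IsOrderPair (Refine _≿_) (Refine _≻_)
  refine-isOrderPair = record
    { quasi  = record
      { isEquivalence = isEquivalence
      ; reflexive     = λ { refl → inj₂ (≳-refl , ≿-refl) }
      ; trans         = refine-trans {_≿_} {_≿_} {_≿_} ≿-trans
      }
    ; strict = record
      { isEquivalence = isEquivalence
      ; irrefl        = λ { refl (inj₁ s>s) → >-irrefl refl s>s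
                          ; refl (inj₂ (_ , s≻s)) → ≻-irrefl refl s≻s }
      ; trans         = refine-trans {_≻_} {_≻_} {_≻_} ≻-trans
      ; <-resp-≈      = resp₂ (Refine _≻_)
      }
    ; compat = λ a≿b b≻c c≿d →
        refine-trans {_≻_} {_≿_} ≻-≿-trans (refine-trans {_≿_} {_≻_} ≿-≻-trans a≿b b≻c) c≿d
    }
    where open IsStrictPartialOrder ≻-isStrictPartialOrder using ()
            renaming (irrefl to ≻-irrefl; trans to ≻-trans)

  refine-stable : (R : Rel S 0ℓ) (h : T → T) → (∀ s t → s ≳ t → h s ≳ h t) → (∀ s t → s > t → h s > h t) →
                  (∀ s → root (h s) ≡ root s) → ∀ s t → Refine R s t → Refine R (h s) (h t)
  refine-stable R h h-≳ h-> root-h s t (inj₁ s>t)       = inj₁ (h-> s t s>t)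
  refine-stable R h h-≳ h-> root-h s t (inj₂ (s≳t , r)) =
    inj₂ (h-≳ s t s≳t , subst₂ R (sym (root-h s)) (sym (root-h t)) r)

  module _ {C : Set} {_>ᶜ_ : Rel C 0ℓ} (measure : T → C)
    (measure-> : ∀ {s t} → s > t → measure s >ᶜ measure t)
    (measure-≳ : ∀ {s t} → s ≳ t → StrictToNonStrict._≤_ _≡_ _>ᶜ_ (measure s) (measure t)) where

    refine-noetherian : WellFounded (flip _>ᶜ_) → WellFounded (flip _≻_) → WellFounded (flip (Refine _≻_))
    refine-noetherian >ᶜ-noetherian ≻-noetherian =
      Subrelation.wellFounded toLex
        (On.wellFounded (λ s → measure s , root s) (×-wellFounded >ᶜ-noetherian ≻-noetherian))
      where
        toLex : ∀ {s t} → Refine _≻_ t s →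
                ×-Lex _≡_ (flip _>ᶜ_) (flip _≻_) (measure s , root s) (measure t , root t)
        toLex (inj₁ t>s) = inj₁ (measure-> t>s)
        toLex (inj₂ (t≳s , t≻s)) with measure-≳ t≳s
        ... | inj₁ t>ᶜs = inj₁ t>ᶜs
        ... | inj₂ t≡s  = inj₂ (sym t≡s , t≻s)

module _ {F : Signature} {V : Set} (𝒜 : OrderedAlgebra F) where
  open OrderedAlgebra 𝒜 using (Carrier; interp)

  mutual
    eval-subst : (α : V → Carrier) (σ : V → Term F V) (t : Term F V) →
                 eval 𝒜 α (t ⟨ σ ⟩) ≡ eval 𝒜 (eval 𝒜 α ∘ σ) t
    eval-subst α σ (var x)    = refl
    eval-subst α σ (fun f ts) = cong (interp f) (evals-substs α σ ts)

    evals-substs : ∀ {n} (α : V → Carrier) (σ : V → Term F V) (ts : Vec (Term F V) n) →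
                   evals 𝒜 α (substs σ ts) ≡ evals 𝒜 (eval 𝒜 α ∘ σ) ts
    evals-substs α σ []       = refl
    evals-substs α σ (t ∷ ts) = cong₂ _∷_ (eval-subst α σ t) (evals-substs α σ ts)

  eval-substNV : (α : V → Carrier) (σ : V → Term F V) (s : NTerm F V) →
                 eval 𝒜 α (proj₁ (substNV σ s)) ≡ eval 𝒜 (eval 𝒜 α ∘ σ) (proj₁ s)
  eval-substNV α σ (fun f ts , tt) = eval-subst α σ (fun f ts)

root-substNV : {F : Signature} {V : Set} (σ : V → Term F V) (s : NTerm F V) → root (substNV σ s) ≡ root s
root-substNV σ (fun f ts , tt) = refl

lemma8 : (F : Signature) (V : Set) → FiniteSignature F →
    (𝒜 : OrderedAlgebra F) → WeaklyMonotone 𝒜 → WellFoundedAlg 𝒜 →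
    (_≿_ : Rel (Sym F) 0ℓ) → IsPrecedence F _≿_ →
    IsStableOrderPair F V (⊐∼ 𝒜 _≿_) (⊐ 𝒜 _≿_)
    × WellFounded (flip (⊐ 𝒜 _≿_ {V}))
lemma8 F V (symbols , enumerates) 𝒜 _ >-noetherian _≿_ ≿-isPreorder =
  (refine-isOrderPair , stable _≿_ , stable (StrictPart _≿_)) ,
  refine-noetherian ⟦ α₀ ⟧ (λ s>t → s>t α₀) (λ s≥t → s≥t α₀)
    >-noetherian (≻-noetherian symbols enumerates)
  where
    open OrderedAlgebra 𝒜 using (Carrier; isStrictOrder; inhabitant)

    ⟦_⟧ : (V → Carrier) → NTerm F V → Carrier
    ⟦ α ⟧ s = eval 𝒜 α (proj₁ s)

    -- Pointwise irreflexivity and the measure both need some assignment.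
    α₀ : V → Carrier
    α₀ _ = inhabitant

    open Pointwise isStrictOrder ⟦_⟧
    open StrictPartProperties ≿-isPreorder using (≻-noetherian)
    open RootRefinement (pointwise-isOrderPair α₀) root ≿-isPreorder

    stable : ∀ R (σ : V → Term F V) {s t} → Refine R s t → Refine R (substNV σ s) (substNV σ t)
    stable R σ {s} {t} = refine-stable R (substNV σ)
      (≥ᵖ-reindex (substNV σ) (λ α → eval 𝒜 α ∘ σ) (λ α → eval-substNV 𝒜 α σ))
      (>ᵖ-reindex (substNV σ) (λ α → eval 𝒜 α ∘ σ) (λ α → eval-substNV 𝒜 α σ))
      (root-substNV σ) s t
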